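{- (No Cycle Lemma.) Let $p$ be a pebble distribution on a simple graph $G$ and $v\in V(G)$. The following are equivalent: (1) $v$ is reachable from $p$; (2) there is a finite multiset $S$ of rubbling moves such that $S$ is balanced with $p$ and $p_S(v)\ge 1$; (3) there is a finite acyclic multiset $R$ of rubbling moves such that $R$ is balanced with $p$ and $p_R(v)\ge 1$; (4) $v$ is reachable from $p$ through an acyclic rubbling sequence.
   Context: A pebble function on $G$ is a function $p:V(G)\to\mathbb{Z}$; a pebble distribution is a nonnegative pebble function. If $\{v,u\}\in E(G)$, the pebbling move $(v,v\to u)$ decreases $p(v)$ by 2 and increases $p(u)$ by 1. If $v\ne w$ and $\{v,u\},\{w,u\}\in E(G)$, the strict rubbling move $(v,w\to u)$ decreases $p(v)$ and $p(w)$ by 1 and increases $p(u)$ by 1. A rubbling move is either of these. For a multiset (or sequence) $S$ of moves, $p_S$ is the result of applying all its moves to $p$ (order irrelevant). $S$ is balanced with $p$ if $p_S\ge 0$ everywhere. The transition digraph $T(G,S)$ is the directed multigraph on $V(G)$ in which each move $(v,w\to u)\in S$ contributes directed edges $(v,u)$ and $(w,u)$; $S$ (or a sequence with multiset of moves $S$) is acyclic if $T(G,S)$ has no directed cycle. A rubbling sequence $(s_1,\dots,s_k)$ is executable from $p$ if the pebble function obtained after applying $s_1,\dots,s_i$ is nonnegative for every $i$. A vertex $v$ is reachable from $p$ (through $s$) if there is an executable rubbling sequence $s$ with $p_s(v)\ge1$. -}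

module Defs where

open import Data.Nat using (ℕ)
open import Data.Integer using (ℤ; +_; -_; _+_; _≤_; 0ℤ; 1ℤ)
open import Data.Fin using (Fin; _≟_)
open import Data.List using (List; []; _∷_; foldl)
open import Data.List.Membership.Propositional using (_∈_)
open import Data.Product using (Σ; ∃; _×_; _,_)
open import Data.Sum using (_⊎_)
open import Data.Unit using (⊤)
open import Relation.Nullary using (¬_; yes; no)
open import Relation.Binary.PropositionalEquality using (_≡_)
open import Relation.Binary.Construct.Closure.Transitive using (TransClosure)

record SimpleGraph (n : ℕ) : Set₁ where
  field
    Adj   : Fin n → Fin n → Set
    sym   : ∀ {x y} → Adj x y → Adj y x
    irrefl : ∀ {x} → ¬ Adj x x

module _ {n : ℕ} (G : SimpleGraph n) where
  open SimpleGraph G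

  data Move : Set where
    pebbling : (v u : Fin n) → Adj v u → Move
    strict   : (v w u : Fin n) → ¬ v ≡ w → Adj v u → Adj w u → Move

  PebbleFn : Set
  PebbleFn = Fin n → ℤ

  δ : Fin n → Fin n → ℤ
  δ a x with a ≟ x
  ... | yes _ = 1ℤ
  ... | no _  = 0ℤ

  change : Move → Fin n → ℤ
  change (pebbling v u _) x = (- (δ v x + δ v x)) + δ u x
  change (strict v w u _ _ _) x = (- (δ v x + δ w x)) + δ u x

  applyMove : PebbleFn → Move → PebbleFn
  applyMove p m x = p x + change m x

  -- p_S : result of applying all moves of S (a finite multiset, given as a list)
  applyAll : PebbleFn → List Move → PebbleFn
  applyAll = foldl applyMove

  NonNeg : PebbleFn → Set
  NonNeg p = ∀ x → 0ℤ ≤ p x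

  Balanced : PebbleFn → List Move → Set
  Balanced p S = NonNeg (applyAll p S)

  sources : Move → Fin n × Fin n
  sources (pebbling v u _) = v , v
  sources (strict v w u _ _ _) = v , w

  target : Move → Fin n
  target (pebbling v u _) = u
  target (strict v w u _ _ _) = u

  Arc : List Move → Fin n → Fin n → Set
  Arc S a b = Σ Move λ m → m ∈ S × target m ≡ b ×
                (let (s₁ , s₂) = sources m in a ≡ s₁ ⊎ a ≡ s₂)

  Acyclic : List Move → Set
  Acyclic S = ∀ x → ¬ TransClosure (Arc S) x x

  Executable : PebbleFn → List Move → Set
  Executable p [] = ⊤
  Executable p (m ∷ s) = NonNeg (applyMove p m) × Executable (applyMove p m) s

  Reachable : PebbleFn → Fin n → Set
  Reachable p v = Σ (List Move) λ s → Executable p s × 1ℤ ≤ applyAll p s v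

  ReachableAcyclic : PebbleFn → Fin n → Set
  ReachableAcyclic p v =
    Σ (List Move) λ s → Executable p s × Acyclic s × 1ℤ ≤ applyAll p s v

-- Two observations drive an induction on the size of a balanced multiset S of
-- moves. If some move m of S is not fed by S (no move of S has a source of m as
-- its target), then the sources of m only lose pebbles in S, so m can be
-- executed first and the rest of S is balanced from the new distribution; no arc
-- of the transition digraph of the rest ends at a source of m, so putting m in
-- front preserves acyclicity. Otherwise every move of S is fed by S, and walking
-- backwards along feeders until a target repeats yields moves with distinct
-- targets, each target being a source of one of them: deleting these moves
-- from S costs no vertex a pebble. Either way we recurse on a smaller multiset
-- and obtain an executable acyclic sequence of moves of S whose final
-- distribution dominates p_S.
module Submission where

open import Defs
open import Data.Nat using (ℕ)
open import Data.Integer using (0ℤ; 1ℤ; _≤_)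
open import Data.Fin using (Fin)
open import Data.List using (List)
open import Data.Product using (Σ; _×_)
open import Function.Bundles using (_⇔_)

import Data.Nat as ℕ
import Data.Nat.Properties as ℕ
open import Data.Nat.Induction using (<-wellFounded)
open import Data.Nat.ListAction using (sum)
open import Data.Nat.ListAction.Properties using (sum-↭)
open import Data.Integer using (ℤ; +_; -_; _+_; _-_; +≤+)
import Data.Integer.Properties as ℤ
open import Data.Empty using (⊥-elim)
open import Data.Integer.Tactic.RingSolver using (solve-∀)
open import Data.Fin using (zero; suc; _≟_)
open import Data.Fin.Properties using (injective⇒≤)
open import Data.List using ([]; _∷_; _++_; _∷ʳ_; length; lookup; map)
import Data.List.Properties as List
open import Data.List.Membership.Propositional using (_∈_; find; lose)
open import Data.List.Membership.Propositional.Properties using (∈-∃++; ∈-lookup)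
open import Data.List.Relation.Binary.Permutation.Propositional
  using (_↭_; ↭-refl; ↭-sym; ↭-trans; ↭-prep)
open import Data.List.Relation.Binary.Permutation.Propositional.Properties
  using (shift; ↭-length) renaming (map⁺ to ↭-map⁺)
open import Data.List.Relation.Binary.Subset.Propositional using (_⊆_)
open import Data.List.Relation.Binary.Subset.Propositional.Properties
  using (⊆-trans; ⊆-respʳ-↭; ⊆-reflexive-↭; ⊆∷∧∉⇒⊆; xs⊆xs++ys; xs⊆ys++xs)
open import Data.List.Relation.Unary.All as All using (All; []; _∷_; all?)
open import Data.List.Relation.Unary.All.Properties using (¬Any⇒All¬; anti-mono)
  renaming (++⁺ to All-++⁺; ++⁻ˡ to All-++⁻ˡ)
open import Data.List.Relation.Unary.AllPairs as AllPairs using (AllPairs; []; _∷_)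
open import Data.List.Relation.Unary.Any using (Any; here; there; any?)
open import Data.List.Relation.Unary.Linked using (Linked; []; [-]; _∷_)
open import Data.List.Relation.Unary.Unique.Propositional using (Unique)
open import Data.List.Relation.Unary.Unique.Propositional.Properties
  using (Unique[x∷xs]⇒x∉xs)
open import Data.Product using (_,_; proj₁; proj₂; ∃; ∃-syntax)
open import Data.Sum as Sum using (_⊎_; inj₁; inj₂)
open import Data.Unit using (tt)
open import Function using (_∘_)
open import Function.Bundles using (mk⇔)
open import Induction.WellFounded using (Acc; acc)
open import Relation.Binary.Core using (Rel)
open import Relation.Binary.PropositionalEquality
  using (_≡_; _≢_; refl; sym; trans; cong; subst)
open import Relation.Binary.Construct.Closure.Transitive using (TransClosure; [_]; _∷_)
open import Relation.Nullary using (¬_; yes; no; Dec)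
open import Relation.Nullary.Decidable using (_⊎-dec_; ¬?)

module _ {a ℓ} {A : Set a} {R : Rel A ℓ} where

  AllPairs-++⁻ˡ : ∀ xs {ys} → AllPairs R (xs ++ ys) → AllPairs R xs
  AllPairs-++⁻ˡ []       _          = []
  AllPairs-++⁻ˡ (x ∷ xs) (px ∷ pxs) = All-++⁻ˡ xs px ∷ AllPairs-++⁻ˡ xs pxs

  Linked-++⁻ˡ : ∀ xs {ys} → Linked R (xs ++ ys) → Linked R xs
  Linked-++⁻ˡ []           _       = []
  Linked-++⁻ˡ (x ∷ [])     _       = [-]
  Linked-++⁻ˡ (x ∷ y ∷ xs) (r ∷ l) = r ∷ Linked-++⁻ˡ (y ∷ xs) l

  Linked⇒successors : ∀ xs {y} → Linked R (xs ∷ʳ y) →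
                      All (λ x → Any (R x) (xs ∷ʳ y)) xs
  Linked⇒successors []           _       = []
  Linked⇒successors (x ∷ [])     (r ∷ _) = there (here r) ∷ []
  Linked⇒successors (x ∷ z ∷ xs) (r ∷ l) =
    there (here r) ∷ All.map there (Linked⇒successors (z ∷ xs) l)

module _ {a} {A : Set a} where

  ∈⇒↭∷ : ∀ {x : A} {xs} → x ∈ xs → ∃[ ys ] xs ↭ x ∷ ys
  ∈⇒↭∷ {x} x∈xs with ys , zs , refl ← ∈-∃++ x∈xs = ys ++ zs , shift x ys zs

  ↭-complement : ∀ {C S : List A} → Unique C → C ⊆ S → ∃[ R ] S ↭ C ++ R
  ↭-complement {[]}    {S} _          _   = S , ↭-refl
  ↭-complement {c ∷ C} {S} (c∉ ∷ C!) C⊆S with S′ , S↭ ← ∈⇒↭∷ (C⊆S (here refl)) =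
    let R , S′↭ = ↭-complement C!
                    (⊆∷∧∉⇒⊆ (⊆-respʳ-↭ S↭ (C⊆S ∘ there)) (Unique[x∷xs]⇒x∉xs (c∉ ∷ C!)))
    in R , ↭-trans S↭ (↭-prep c S′↭)

  ↭-++-length-< : ∀ {S} (C : List A) {R} → S ↭ C ++ R → 0 ℕ.< length C →
                  length R ℕ.< length S
  ↭-++-length-< C S↭ 0<∣C∣ =
    subst (_ ℕ.<_) (sym (trans (↭-length S↭) (List.length-++ C))) (ℕ.m<n+m _ 0<∣C∣)

-- For moves, key is the target and y ▷ m says that y is a source of m.
module CycleSearch {A : Set} {k : ℕ} (key : A → Fin k) (_▷_ : Fin k → A → Set) where

  Feeds : A → A → Set
  Feeds a b = key a ▷ b

  Fed : List A → Set
  Fed S = ∀ {b} → b ∈ S → Any (λ a → Feeds a b) S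

  KeyDistinct : List A → Set
  KeyDistinct = AllPairs (λ a b → key a ≢ key b)

  Closed : List A → Set
  Closed C = All (λ c → Any (Feeds c) C) C

  KeyDistinct⇒Unique : ∀ {C} → KeyDistinct C → Unique C
  KeyDistinct⇒Unique = AllPairs.map (λ key≢ a≡b → key≢ (cong key a≡b))

  KeyDistinct⇒length≤ : ∀ {L} → KeyDistinct L → length L ℕ.≤ k
  KeyDistinct⇒length≤ dist = injective⇒≤ (lookup-injective dist)
    where
    lookup-injective : ∀ {L} → KeyDistinct L → ∀ {i j} →
                       key (lookup L i) ≡ key (lookup L j) → i ≡ j
    lookup-injective {_ ∷ _} _             {zero}  {zero}  _ = refl
    lookup-injective {_ ∷ _} (fresh ∷ _)   {zero}  {suc j} e = ⊥-elim (All.lookup fresh (∈-lookup j) e)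
    lookup-injective {_ ∷ _} (fresh ∷ _)   {suc i} {zero}  e = ⊥-elim (All.lookup fresh (∈-lookup i) (sym e))
    lookup-injective {_ ∷ _} (_ ∷ dist′)   {suc i} {suc j} e = cong suc (lookup-injective dist′ e)

  record ClosedFamily (S : List A) : Set where
    field
      family      : List A
      nonempty    : 0 ℕ.< length family
      ⊆S          : family ⊆ S
      keyDistinct : KeyDistinct family
      closed      : Closed family

  private
    head∈prefix : ∀ ys {h c : A} {L zs} → h ∷ L ≡ ys ++ c ∷ zs → h ∈ ys ∷ʳ c
    head∈prefix []      refl = here refl
    head∈prefix (_ ∷ _) refl = here refl

    -- The walk h ∷ L runs backwards along feeders, newest first. The fuel f
    -- cannot run out, since h ∷ L is key-distinct and hence no longer than k.
    walk : ∀ {S} → Fed S → ∀ f h L → length L ℕ.+ f ≡ k → h ∷ L ⊆ S →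
           Linked Feeds (h ∷ L) → KeyDistinct (h ∷ L) → ClosedFamily S
    walk fed ℕ.zero h L len _ _ dist =
      ⊥-elim (ℕ.<-irrefl (trans (sym (ℕ.+-identityʳ _)) len) (KeyDistinct⇒length≤ dist))
    walk fed (ℕ.suc f) h L len sub chain dist
      with m , m∈S , m▷h ← find (fed (sub (here refl)))
      with any? (λ c → key c ≟ key m) (h ∷ L)
    ... | no fresh =
      walk fed f m (h ∷ L) (trans (sym (ℕ.+-suc _ f)) len)
        (λ { (here refl) → m∈S ; (there x∈) → sub x∈ })
        (m▷h ∷ chain)
        (All.map (λ c≢m → c≢m ∘ sym) (¬Any⇒All¬ (h ∷ L) fresh) ∷ dist)
    ... | yes repeat
      with c , c∈ , c≡m ← find repeat
      with ys , zs , split ← ∈-∃++ c∈ = record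
      { family      = ys ∷ʳ c
      ; nonempty    = subst (0 ℕ.<_) (sym (List.length-++ ys)) (ℕ.m≤n+m 1 (length ys))
      ; ⊆S          = sub ∘ subst (_ ∈_) (sym split′) ∘ xs⊆xs++ys (ys ∷ʳ c) zs
      ; keyDistinct = AllPairs-++⁻ˡ (ys ∷ʳ c) (subst KeyDistinct split′ dist)
      ; closed      = All-++⁺ (Linked⇒successors ys prefix-chain) (c-feeds-head ∷ [])
      }
      where
      split′ : h ∷ L ≡ (ys ∷ʳ c) ++ zs
      split′ = trans split (sym (List.++-assoc ys (c ∷ []) zs))
      prefix-chain : Linked Feeds (ys ∷ʳ c)
      prefix-chain = Linked-++⁻ˡ (ys ∷ʳ c) (subst (Linked Feeds) split′ chain)
      c-feeds-head : Any (Feeds c) (ys ∷ʳ c)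
      c-feeds-head = lose (head∈prefix ys split) (subst (_▷ h) (sym c≡m) m▷h)

  closedFamily : ∀ {S a} → Fed S → a ∈ S → ClosedFamily S
  closedFamily fed a∈S =
    walk fed k _ [] refl (λ { (here refl) → a∈S ; (there ()) }) [-] ([] ∷ [])

module _ {n : ℕ} (G : SimpleGraph n) where
  open SimpleGraph G using (Adj; irrefl)

  private
    Mv = Move G

  source₁ source₂ : Mv → Fin n
  source₁ m = proj₁ (sources G m)
  source₂ m = proj₂ (sources G m)

  IsSource : Mv → Fin n → Set
  IsSource m a = a ≡ source₁ m ⊎ a ≡ source₂ m

  isSource? : ∀ m a → Dec (IsSource m a)
  isSource? m a = (a ≟ source₁ m) ⊎-dec (a ≟ source₂ m)

  target-not-source : ∀ m → ¬ IsSource m (target G m)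
  target-not-source (pebbling v u vu)       (inj₁ u≡v) = irrefl (subst (Adj v) u≡v vu)
  target-not-source (pebbling v u vu)       (inj₂ u≡v) = irrefl (subst (Adj v) u≡v vu)
  target-not-source (strict v w u _ vu wu) (inj₁ u≡v) = irrefl (subst (Adj v) u≡v vu)
  target-not-source (strict v w u _ vu wu) (inj₂ u≡w) = irrefl (subst (Adj w) u≡w wu)

  open CycleSearch (target G) (λ y m → IsSource m y) public

  Free : List Mv → Mv → Set
  Free S m = All (λ c → ¬ Feeds c m) S

  free-or-fed : ∀ S → (∃ λ m → m ∈ S × Free S m) ⊎ Fed S
  free-or-fed S with any? (λ m → all? (λ c → ¬? (isSource? m (target G c))) S) S
  ... | yes someFree = inj₁ (find someFree)
  ... | no noneFree = inj₂ fed
    where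
    fed : Fed S
    fed {m} m∈S with any? (λ c → isSource? m (target G c)) S
    ... | yes feeder = feeder
    ... | no  nofeeder = ⊥-elim (noneFree (lose m∈S (¬Any⇒All¬ S nofeeder)))

  δℕ : Fin n → Fin n → ℕ
  δℕ a x with a ≟ x
  ... | yes _ = 1
  ... | no  _ = 0

  δ≡+δℕ : ∀ a x → δ G a x ≡ + δℕ a x
  δ≡+δℕ a x with a ≟ x
  ... | yes _ = refl
  ... | no  _ = refl

  δℕ-≢ : ∀ {a x} → a ≢ x → δℕ a x ≡ 0
  δℕ-≢ {a} {x} a≢x with a ≟ x
  ... | yes a≡x = ⊥-elim (a≢x a≡x)
  ... | no  _   = refl

  δℕ-≡ : ∀ {a x} → a ≡ x → δℕ a x ≡ 1
  δℕ-≡ {a} {x} a≡x with a ≟ x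
  ... | yes _   = refl
  ... | no  a≢x = ⊥-elim (a≢x a≡x)

  lost : Mv → Fin n → ℕ
  lost m x = δℕ (source₁ m) x ℕ.+ δℕ (source₂ m) x

  gain loss : List Mv → Fin n → ℕ
  gain S x = sum (map (λ m → δℕ (target G m) x) S)
  loss S x = sum (map (λ m → lost m x) S)

  change≡ : ∀ m x → change G m x ≡ + δℕ (target G m) x - + lost m x
  change≡ (pebbling v u _) x
    rewrite δ≡+δℕ v x | δ≡+δℕ u x | sym (ℤ.pos-+ (δℕ v x) (δℕ v x)) =
    ℤ.+-comm (- + (δℕ v x ℕ.+ δℕ v x)) (+ δℕ u x)
  change≡ (strict v w u _ _ _) x
    rewrite δ≡+δℕ v x | δ≡+δℕ w x | δ≡+δℕ u x | sym (ℤ.pos-+ (δℕ v x) (δℕ w x)) =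
    ℤ.+-comm (- + (δℕ v x ℕ.+ δℕ w x)) (+ δℕ u x)

  applyAll≡ : ∀ p S x → applyAll G p S x ≡ p x + (+ gain S x - + loss S x)
  applyAll≡ p []      x = sym (ℤ.+-identityʳ (p x))
  applyAll≡ p (m ∷ S) x
    rewrite applyAll≡ (applyMove G p m) S x | change≡ m x
          | ℤ.pos-+ (δℕ (target G m) x) (gain S x) | ℤ.pos-+ (lost m x) (loss S x) =
    regroup (p x) (+ δℕ (target G m) x) (+ lost m x) (+ gain S x) (+ loss S x)
    where
    regroup : ∀ (p g l g′ l′ : ℤ) → (p + (g - l)) + (g′ - l′) ≡ p + ((g + g′) - (l + l′))
    regroup = solve-∀

  applyAll-↭ : ∀ p {S S′} → S ↭ S′ → ∀ x → applyAll G p S x ≡ applyAll G p S′ x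
  applyAll-↭ p {S} {S′} S↭S′ x
    rewrite applyAll≡ p S x | applyAll≡ p S′ x
          | sum-↭ (↭-map⁺ (λ m → δℕ (target G m) x) S↭S′)
          | sum-↭ (↭-map⁺ (λ m → lost m x) S↭S′) = refl

  applyAll-mono : ∀ {p q} S → (∀ x → p x ≤ q x) → ∀ x → applyAll G p S x ≤ applyAll G q S x
  applyAll-mono {p} {q} S p≤q x
    rewrite applyAll≡ p S x | applyAll≡ q S x = ℤ.+-monoˡ-≤ _ (p≤q x)

  applyAll-≤ : ∀ p S x → gain S x ℕ.≤ loss S x → applyAll G p S x ≤ p x
  applyAll-≤ p S x gain≤loss rewrite applyAll≡ p S x =
    ℤ.≤-trans (ℤ.+-monoʳ-≤ (p x) (ℤ.i≤j⇒i-j≤0 (+≤+ gain≤loss)))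
              (ℤ.≤-reflexive (ℤ.+-identityʳ (p x)))

  ≤-applyMove : ∀ p m x → ¬ IsSource m x → p x ≤ applyMove G p m x
  ≤-applyMove p m x not-source
    rewrite change≡ m x
          | δℕ-≢ {source₁ m} {x} (not-source ∘ inj₁ ∘ sym)
          | δℕ-≢ {source₂ m} {x} (not-source ∘ inj₂ ∘ sym)
          | ℤ.+-identityʳ (+ δℕ (target G m) x) = ℤ.i≤i+j (p x) _

  gain≡0 : ∀ S x → All (λ c → target G c ≢ x) S → gain S x ≡ 0
  gain≡0 []      x []           = refl
  gain≡0 (c ∷ S) x (c↛x ∷ S↛x) rewrite δℕ-≢ c↛x = gain≡0 S x S↛x

  gain≤1 : ∀ {S} x → KeyDistinct S → gain S x ℕ.≤ 1
  gain≤1 x [] = ℕ.z≤n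
  gain≤1 {c ∷ S} x (fresh ∷ dist) with target G c ≟ x
  ... | yes refl rewrite gain≡0 S x (All.map (_∘ sym) fresh) = ℕ.≤-refl
  ... | no  _    = gain≤1 x dist

  1≤loss : ∀ {S} x → Any (λ c → IsSource c x) S → 1 ℕ.≤ loss S x
  1≤loss {c ∷ S} x (here (inj₁ x≡s₁)) rewrite δℕ-≡ (sym x≡s₁) = ℕ.s≤s ℕ.z≤n
  1≤loss {c ∷ S} x (here (inj₂ x≡s₂)) rewrite δℕ-≡ (sym x≡s₂) =
    ℕ.≤-trans (ℕ.m≤n+m 1 (δℕ (source₁ c) x)) (ℕ.m≤m+n _ (loss S x))
  1≤loss {c ∷ S} x (there source) = ℕ.≤-trans (1≤loss x source) (ℕ.m≤n+m _ (lost c x))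

  -- Each vertex is the target of at most one move of a closed family, and then
  -- also a source of one of its moves.
  Closed⇒gain≤loss : ∀ {C} → KeyDistinct C → Closed C → ∀ x → gain C x ℕ.≤ loss C x
  Closed⇒gain≤loss {C} dist closed x with any? (λ c → target G c ≟ x) C
  ... | no  untargeted =
    subst (ℕ._≤ loss C x) (sym (gain≡0 C x (¬Any⇒All¬ C untargeted))) ℕ.z≤n
  ... | yes targeted with c , c∈C , c→x ← find targeted =
    ℕ.≤-trans (gain≤1 x dist)
              (1≤loss x (subst (λ y → Any (λ c′ → IsSource c′ y) C) c→x (All.lookup closed c∈C)))

  acyclic-[] : Acyclic G []
  acyclic-[] _ [ _ , () , _ ]
  acyclic-[] _ ((_ , () , _) ∷ _)

  arc-∷ : ∀ {m s a b} → Arc G (m ∷ s) a b → IsSource m a ⊎ Arc G s a b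
  arc-∷ (_ , here refl , _    , a-src) = inj₁ a-src
  arc-∷ (c , there c∈s , c→b , a-src) = inj₂ (c , c∈s , c→b , a-src)

  module _ {m : Mv} {s : List Mv} (free : Free s m) where

    arc-avoids-sources : ∀ {a b} → Arc G (m ∷ s) a b → ¬ IsSource m b
    arc-avoids-sources (_ , here refl , refl , _) = target-not-source m
    arc-avoids-sources (c , there c∈s , refl , _) = All.lookup free c∈s

    path-avoids-sources : ∀ {a b} → TransClosure (Arc G (m ∷ s)) a b → ¬ IsSource m b
    path-avoids-sources [ arc ]  = arc-avoids-sources arc
    path-avoids-sources (_ ∷ path) = path-avoids-sources path

    path-∷ : ∀ {a b} → TransClosure (Arc G (m ∷ s)) a b →
             IsSource m a ⊎ TransClosure (Arc G s) a b
    path-∷ [ arc ] = Sum.map₂ [_] (arc-∷ arc)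
    path-∷ (arc ∷ path) with path-∷ path
    ... | inj₁ source = ⊥-elim (arc-avoids-sources arc source)
    ... | inj₂ path′  = Sum.map₂ (_∷ path′) (arc-∷ arc)

    acyclic-∷ : Acyclic G s → Acyclic G (m ∷ s)
    acyclic-∷ acyclic x cycle with path-∷ cycle
    ... | inj₁ source = path-avoids-sources cycle source
    ... | inj₂ cycle′ = acyclic x cycle′

  executable⇒balanced : ∀ {p} s → NonNeg G p → Executable G p s → Balanced G p s
  executable⇒balanced []      p≥0 _             = p≥0
  executable⇒balanced (m ∷ s) _   (p′≥0 , exec) = executable⇒balanced s p′≥0 exec

  record Schedule (p : PebbleFn G) (S : List Mv) : Set where
    field
      moves      : List Mv
      executable : Executable G p moves
      acyclic    : Acyclic G moves
      dominates  : ∀ x → applyAll G p S x ≤ applyAll G p moves x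
      ⊆S         : moves ⊆ S

  -- At a source of m no move of R adds pebbles, so there applyMove p m
  -- dominates p_S ≥ 0.
  first-move-nonneg : ∀ {p S R m} → Free R m → S ↭ m ∷ R → NonNeg G p → Balanced G p S →
                      NonNeg G (applyMove G p m)
  first-move-nonneg {p} {S} {R} {m} free S↭ p≥0 balanced x with isSource? m x
  ... | no  not-source = ℤ.≤-trans (p≥0 x) (≤-applyMove p m x not-source)
  ... | yes source     = begin
    0ℤ                                ≤⟨ balanced x ⟩
    applyAll G p S x                  ≡⟨ applyAll-↭ p S↭ x ⟩
    applyAll G (applyMove G p m) R x  ≤⟨ applyAll-≤ (applyMove G p m) R x gain≤loss ⟩
    applyMove G p m x                 ∎
    where
    open ℤ.≤-Reasoning
    R-misses-x : All (λ c → target G c ≢ x) R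
    R-misses-x = All.map (λ c↛m c→x → c↛m (subst (IsSource m) (sym c→x) source)) free
    gain≤loss : gain R x ℕ.≤ loss R x
    gain≤loss rewrite gain≡0 R x R-misses-x = ℕ.z≤n

  removing-closed-≤ : ∀ p {S C R} → S ↭ C ++ R → KeyDistinct C → Closed C →
                      ∀ x → applyAll G p S x ≤ applyAll G p R x
  removing-closed-≤ p {S} {C} {R} S↭ dist closed x = begin
    applyAll G p S x                  ≡⟨ applyAll-↭ p S↭ x ⟩
    applyAll G p (C ++ R) x           ≡⟨ cong (λ q → q x) (List.foldl-++ (applyMove G) p C R) ⟩
    applyAll G (applyAll G p C) R x   ≤⟨ applyAll-mono R C-harmless x ⟩
    applyAll G p R x                  ∎
    where
    open ℤ.≤-Reasoning
    C-harmless : ∀ y → applyAll G p C y ≤ p y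
    C-harmless y = applyAll-≤ p C y (Closed⇒gain≤loss dist closed y)

  ShorterSchedulable : List Mv → Set
  ShorterSchedulable S =
    ∀ {q} R → length R ℕ.< length S → NonNeg G q → Balanced G q R → Schedule q R

  schedule-free : ∀ {p S m} → ShorterSchedulable S → m ∈ S → Free S m →
                  NonNeg G p → Balanced G p S → Schedule p S
  schedule-free {p} {S} {m} rec m∈S free p≥0 balanced = record
    { moves      = m ∷ moves
    ; executable = p′≥0 , executable
    ; acyclic    = acyclic-∷ (anti-mono ⊆S freeR) acyclic
    ; dominates  = λ x → ℤ.≤-trans (ℤ.≤-reflexive (applyAll-↭ p S↭ x)) (dominates x)
    ; ⊆S         = ⊆-trans m∷⊆m∷R (⊆-reflexive-↭ (↭-sym S↭))
    }
    where
    R = proj₁ (∈⇒↭∷ m∈S)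
    S↭ : S ↭ m ∷ R
    S↭ = proj₂ (∈⇒↭∷ m∈S)
    freeR : Free R m
    freeR = anti-mono (⊆-trans (xs⊆ys++xs R (m ∷ [])) (⊆-reflexive-↭ (↭-sym S↭))) free
    p′≥0 : NonNeg G (applyMove G p m)
    p′≥0 = first-move-nonneg freeR S↭ p≥0 balanced
    open Schedule (rec R (↭-++-length-< (m ∷ []) S↭ (ℕ.s≤s ℕ.z≤n)) p′≥0
                         (λ x → subst (0ℤ ≤_) (applyAll-↭ p S↭ x) (balanced x)))
    m∷⊆m∷R : m ∷ moves ⊆ m ∷ R
    m∷⊆m∷R (here refl) = here refl
    m∷⊆m∷R (there x∈)  = there (⊆S x∈)

  schedule-fed : ∀ {p S a} → ShorterSchedulable S → Fed S → a ∈ S →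
                 NonNeg G p → Balanced G p S → Schedule p S
  schedule-fed {p} {S} rec fed a∈S p≥0 balanced = record
    { moves      = moves
    ; executable = executable
    ; acyclic    = acyclic
    ; dominates  = λ x → ℤ.≤-trans (removing-closed-≤ p S↭ keyDistinct closed x) (dominates x)
    ; ⊆S         = ⊆-trans (⊆-trans ⊆S (xs⊆ys++xs R family)) (⊆-reflexive-↭ (↭-sym S↭))
    }
    where
    open ClosedFamily (closedFamily fed a∈S) renaming (⊆S to family⊆S)
    R = proj₁ (↭-complement (KeyDistinct⇒Unique keyDistinct) family⊆S)
    S↭ : S ↭ family ++ R
    S↭ = proj₂ (↭-complement (KeyDistinct⇒Unique keyDistinct) family⊆S)
    open Schedule (rec R (↭-++-length-< family S↭ nonempty) p≥0
                         (λ x → ℤ.≤-trans (balanced x) (removing-closed-≤ p S↭ keyDistinct closed x)))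

  schedule-acc : ∀ {p} S → Acc ℕ._<_ (length S) → NonNeg G p → Balanced G p S → Schedule p S
  schedule-acc [] _ _ _ = record
    { moves = [] ; executable = tt ; acyclic = acyclic-[] ; dominates = λ _ → ℤ.≤-refl ; ⊆S = λ () }
  schedule-acc S@(_ ∷ _) (acc rs) =
    Sum.[ (λ (_ , m∈S , free) → schedule-free shorter m∈S free)
        , (λ (fed : Fed S) → schedule-fed shorter fed (here refl)) ]′ (free-or-fed S)
    where
    shorter : ShorterSchedulable S
    shorter R R<S = schedule-acc R (rs R<S)

  schedule : ∀ {p S} → NonNeg G p → Balanced G p S → Schedule p S
  schedule {S = S} = schedule-acc S (<-wellFounded (length S))

  balanced⇒reachableAcyclic : ∀ {p v} S → NonNeg G p → Balanced G p S → 1ℤ ≤ applyAll G p S v →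
                              ReachableAcyclic G p v
  balanced⇒reachableAcyclic {v = v} S p≥0 balanced hit =
    moves , executable , acyclic , ℤ.≤-trans hit (dominates v)
    where open Schedule (schedule {S = S} p≥0 balanced)

mainTheorem4 : ∀ {n : ℕ} (G : SimpleGraph n) (p : PebbleFn G) (v : Fin n) →
    (∀ x → 0ℤ ≤ p x) →
    (Reachable G p v ⇔ (Σ (List (Move G)) λ S → Balanced G p S × 1ℤ ≤ applyAll G p S v))
    × (Reachable G p v ⇔ (Σ (List (Move G)) λ R → Acyclic G R × Balanced G p R × 1ℤ ≤ applyAll G p R v))
    × (Reachable G p v ⇔ ReachableAcyclic G p v)
mainTheorem4 G p v p≥0 =
  mk⇔ toBalanced (forgetAcyclic ∘ fromBalanced) ,
  mk⇔ (toAcyclicBalanced ∘ fromBalanced ∘ toBalanced)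
      (λ (R , _ , balanced , hit) → forgetAcyclic (fromBalanced (R , balanced , hit))) ,
  mk⇔ (fromBalanced ∘ toBalanced) forgetAcyclic
  where
  BalancedHit : Set
  BalancedHit = Σ (List (Move G)) λ S → Balanced G p S × 1ℤ ≤ applyAll G p S v

  toBalanced : Reachable G p v → BalancedHit
  toBalanced (s , exec , hit) = s , executable⇒balanced G s p≥0 exec , hit

  fromBalanced : BalancedHit → ReachableAcyclic G p v
  fromBalanced (S , balanced , hit) = balanced⇒reachableAcyclic G S p≥0 balanced hit

  forgetAcyclic : ReachableAcyclic G p v → Reachable G p v
  forgetAcyclic (s , exec , _ , hit) = s , exec , hit

  toAcyclicBalanced : ReachableAcyclic G p v →
                      Σ (List (Move G)) λ R → Acyclic G R × Balanced G p R × 1ℤ ≤ applyAll G p R v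
  toAcyclicBalanced (s , exec , acyclic , hit) = s , acyclic , executable⇒balanced G s p≥0 exec , hit
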